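{- For a finite graph $G$ without isolated vertices let $\mathrm{h\,avg\,val}(G)=\frac{|V(G)|}{\sum_{v\in V(G)}\frac{1}{\mathrm{degree}(v)}}$ be the harmonic mean of the vertex degrees. Then the connection matrix $M(\bowtie,\mathrm{h\,avg\,val})$ has infinite rank.
   Context: The join $G\bowtie H$ of two graphs is obtained from their disjoint union by adding all edges between vertices of $G$ and vertices of $H$; for nonempty $G,H$ it has no isolated vertices. $M(\bowtie,\mathrm{h\,avg\,val})$ is the infinite matrix with rows and columns indexed by finite nonempty graphs, with entry $\mathrm{h\,avg\,val}(G\bowtie H)$ at $(G,H)$; rank is over $\mathbb{Q}$. -}

module Defs where

open import Data.Nat using (ℕ; zero; suc; _+_; _<_)
open import Data.Fin using (Fin; splitAt)
import Data.Fin as Fin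
open import Data.Bool using (Bool; true; false; if_then_else_)
open import Data.Sum using (inj₁; inj₂)
open import Data.Integer using (+_)
open import Data.Rational as ℚ using (ℚ; 0ℚ; 1/_; ≢-nonZero)
open import Relation.Nullary using (yes; no)
open import Relation.Binary.PropositionalEquality using (_≡_; refl)

record Graph : Set where
  field
    n      : ℕ
    adj    : Fin n → Fin n → Bool
    sym    : ∀ i j → adj i j ≡ adj j i
    irrefl : ∀ i → adj i i ≡ false
open Graph public

Nonempty : Graph → Set
Nonempty G = 0 < n G

sumFin : {A : Set} → (A → A → A) → A → (k : ℕ) → (Fin k → A) → A
sumFin _⊕_ e zero    f = e
sumFin _⊕_ e (suc k) f = f Fin.zero ⊕ sumFin _⊕_ e k (λ i → f (Fin.suc i))

degree : (G : Graph) → Fin (n G) → ℕ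
degree G v = sumFin _+_ 0 (n G) (λ w → if adj G v w then 1 else 0)

-- reciprocal in ℚ, with the convention 1/0 := 0 (never used on joins)
recip : ℚ → ℚ
recip q with q ℚ.≟ 0ℚ
... | yes _ = 0ℚ
... | no q≢0 = 1/_ q {{≢-nonZero q≢0}}

havgval : Graph → ℚ
havgval G = (+ n G ℚ./ 1) ℚ.* recip (sumFin ℚ._+_ 0ℚ (n G) (λ v → recip (+ degree G v ℚ./ 1)))

joinAdj : (G H : Graph) → Fin (n G + n H) → Fin (n G + n H) → Bool
joinAdj G H i j with splitAt (n G) i | splitAt (n G) j
... | inj₁ a | inj₁ b = adj G a b
... | inj₂ a | inj₂ b = adj H a b
... | inj₁ _ | inj₂ _ = true
... | inj₂ _ | inj₁ _ = true

joinSym : (G H : Graph) → ∀ i j → joinAdj G H i j ≡ joinAdj G H j i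
joinSym G H i j with splitAt (n G) i | splitAt (n G) j
... | inj₁ a | inj₁ b = sym G a b
... | inj₂ a | inj₂ b = sym H a b
... | inj₁ _ | inj₂ _ = refl
... | inj₂ _ | inj₁ _ = refl

joinIrrefl : (G H : Graph) → ∀ i → joinAdj G H i i ≡ false
joinIrrefl G H i with splitAt (n G) i
... | inj₁ a = irrefl G a
... | inj₂ a = irrefl H a

_⋈_ : Graph → Graph → Graph
G ⋈ H = record
  { n = n G + n H
  ; adj = joinAdj G H
  ; sym = joinSym G H
  ; irrefl = joinIrrefl G H
  }

M : Graph → Graph → ℚ
M G H = havgval (G ⋈ H)

RowsIndependent : (k : ℕ) → (Fin k → Graph) → Set
RowsIndependent k Gs =
  (c : Fin k → ℚ) →
  ((H : Graph) → Nonempty H → sumFin ℚ._+_ 0ℚ k (λ i → c i ℚ.* M (Gs i) H) ≡ 0ℚ) →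
  ∀ i → c i ≡ 0ℚ

InfiniteRank : Set
InfiniteRank = (k : ℕ) → Σ (Fin k → Graph) (λ Gs → ((i : Fin k) → Nonempty (Gs i)) × RowsIndependent k Gs)
  where open import Data.Product using (Σ; _×_)

-- Let D(s, j) be the j-fold self-join of the edgeless graph on 2^s vertices. For s < k the
-- graph D(s, k - s) has N = 2^k vertices and is (N - 2^s)-regular. The join of a d-regular
-- and an e-regular graph on N vertices each has harmonic mean degree 2N / (α_d + α_e) with
-- α_d = N / (d + N), so the k rows indexed by s < k form, up to the factor 2N, the Cauchy
-- matrix 1 / (α_i + α_j) with pairwise distinct positive α_i. A Cauchy matrix is nonsingular
-- (eliminate the first row and column and induct), so the rank of M is at least k for every k.
module Submission where

open import Defs hiding (sym)

open import Algebra.Structures using (IsMonoid)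
open import Data.Bool using (true; false; if_then_else_)
open import Data.Empty using (⊥-elim)
open import Data.Fin as Fin using (Fin; zero; suc; toℕ; _↑ˡ_; _↑ʳ_; splitAt)
import Data.Fin.Properties as Finₚ
open import Data.Integer as ℤ using (+_)
import Data.Integer.Properties as ℤₚ
open import Data.Nat as ℕ using (ℕ; zero; suc; _^_; _∸_)
import Data.Nat.Coprimality as Coprime
open import Data.Nat.Logarithm using (⌊log₂_⌋; ⌊log₂[2^n]⌋≡n)
import Data.Nat.Properties as ℕₚ
open import Data.Product using (_,_)
open import Data.Rational as ℚ using (ℚ; 0ℚ; 1ℚ; _+_; _*_; _-_; -_; _<_; mkℚ)
import Data.Rational.Properties as ℚₚ
open import Data.Rational.Solver using (module +-*-Solver)
import Data.Rational.Unnormalised as ℚᵘ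
import Data.Rational.Unnormalised.Properties as ℚᵘₚ
open import Data.Sum using (inj₁; inj₂)
open import Function.Base using (_∘_)
open import Function.Definitions using (Injective)
open import Relation.Binary.PropositionalEquality
open import Relation.Nullary using (yes; no)

import Algebra.Properties.Group as GroupProperties
open GroupProperties ℚₚ.+-0-group using (x∙y⁻¹≈ε⇒x≈y; inverseʳ-unique)
open +-*-Solver using (solve; con; _:+_; _:-_; _:*_; _:=_)

module _ {A : Set} {_⊕_ : A → A → A} {e : A} where

  sumFin-cong : ∀ k {f g : Fin k → A} → (∀ i → f i ≡ g i) → sumFin _⊕_ e k f ≡ sumFin _⊕_ e k g
  sumFin-cong zero    f≗g = refl
  sumFin-cong (suc k) f≗g = cong₂ _⊕_ (f≗g zero) (sumFin-cong k (λ i → f≗g (suc i)))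

  sumFin-++ : IsMonoid _≡_ _⊕_ e → ∀ m n (f : Fin (m ℕ.+ n) → A) →
    sumFin _⊕_ e (m ℕ.+ n) f ≡ sumFin _⊕_ e m (λ i → f (i ↑ˡ n)) ⊕ sumFin _⊕_ e n (λ j → f (m ↑ʳ j))
  sumFin-++ monoid zero    n f = sym (IsMonoid.identityˡ monoid _)
  sumFin-++ monoid (suc m) n f = trans (cong (f zero ⊕_) (sumFin-++ monoid m n (λ i → f (suc i))))
                                       (sym (IsMonoid.assoc monoid _ _ _))

sumℕ-const : ∀ k c → sumFin ℕ._+_ 0 k (λ _ → c) ≡ k ℕ.* c
sumℕ-const zero    c = refl
sumℕ-const (suc k) c = cong (c ℕ.+_) (sumℕ-const k c)

sumℚ : (k : ℕ) → (Fin k → ℚ) → ℚ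
sumℚ = sumFin _+_ 0ℚ

sumℚ-zero : ∀ k {f : Fin k → ℚ} → (∀ i → f i ≡ 0ℚ) → sumℚ k f ≡ 0ℚ
sumℚ-zero zero    f≡0 = refl
sumℚ-zero (suc k) f≡0 = trans (cong₂ _+_ (f≡0 zero) (sumℚ-zero k (λ i → f≡0 (suc i)))) (ℚₚ.+-identityˡ 0ℚ)

sumℚ-*ʳ : ∀ k z (f : Fin k → ℚ) → sumℚ k (λ i → f i * z) ≡ sumℚ k f * z
sumℚ-*ʳ zero    z f = sym (ℚₚ.*-zeroˡ z)
sumℚ-*ʳ (suc k) z f = trans (cong (_+_ (f zero * z)) (sumℚ-*ʳ k z (λ i → f (suc i))))
                            (sym (ℚₚ.*-distribʳ-+ z (f zero) _))

sumℚ-linear : ∀ k x y (f g : Fin k → ℚ) → sumℚ k (λ i → x * f i - y * g i) ≡ x * sumℚ k f - y * sumℚ k g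
sumℚ-linear zero    x y f g = solve 2 (λ x y → con 0ℚ := x :* con 0ℚ :- y :* con 0ℚ) refl x y
sumℚ-linear (suc k) x y f g = trans (cong (_+_ (x * f zero - y * g zero)) (sumℚ-linear k x y (λ i → f (suc i)) (λ i → g (suc i))))
  (solve 6 (λ x y f₀ g₀ F G → (x :* f₀ :- y :* g₀) :+ (x :* F :- y :* G) := x :* (f₀ :+ F) :- y :* (g₀ :+ G))
    refl x y (f zero) (g zero) (sumℚ k (λ i → f (suc i))) (sumℚ k (λ i → g (suc i))))

fromℕ : ℕ → ℚ
fromℕ n = + n ℚ./ 1

fromℕ≡mkℚ : ∀ n → fromℕ n ≡ mkℚ (+ n) 0 (Coprime.sym (Coprime.1-coprimeTo n))
fromℕ≡mkℚ n = ℚₚ.normalize-coprime (Coprime.sym (Coprime.1-coprimeTo n))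

fromℕ-+ : ∀ m n → fromℕ (m ℕ.+ n) ≡ fromℕ m + fromℕ n
fromℕ-+ m n = ℚₚ.toℚᵘ-injective (ℚᵘₚ.≃-trans toℚᵘ-sum (ℚᵘₚ.≃-sym (ℚₚ.toℚᵘ-homo-+ (fromℕ m) (fromℕ n))))
  where
  toℚᵘ-sum : ℚ.toℚᵘ (fromℕ (m ℕ.+ n)) ℚᵘ.≃ ℚ.toℚᵘ (fromℕ m) ℚᵘ.+ ℚ.toℚᵘ (fromℕ n)
  toℚᵘ-sum rewrite fromℕ≡mkℚ (m ℕ.+ n) | fromℕ≡mkℚ m | fromℕ≡mkℚ n =
    ℚᵘ.*≡* (trans (ℤₚ.*-identityʳ _) (trans (ℤₚ.pos-+ m n) (sym (trans (ℤₚ.*-identityʳ _)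
      (cong₂ ℤ._+_ (ℤₚ.*-identityʳ (+ m)) (ℤₚ.*-identityʳ (+ n)))))))

fromℕ-injective : Injective _≡_ _≡_ fromℕ
fromℕ-injective {m} {n} eq = ℤₚ.+-injective (cong ℚ.↥_ (trans (sym (fromℕ≡mkℚ m)) (trans eq (fromℕ≡mkℚ n))))

fromℕ-pos : ∀ {n} → 0 ℕ.< n → 0ℚ < fromℕ n
fromℕ-pos {n} 0<n = ℚₚ.positive⁻¹ (fromℕ n) {{ℚₚ.normalize-pos n 1}}
  where instance _ = ℕ.>-nonZero 0<n

sumℚ-const : ∀ k c → sumℚ k (λ _ → c) ≡ fromℕ k * c
sumℚ-const zero    c = sym (ℚₚ.*-zeroˡ c)
sumℚ-const (suc k) c = begin
  c + sumℚ k (λ _ → c)     ≡⟨ cong₂ _+_ (sym (ℚₚ.*-identityˡ c)) (sumℚ-const k c) ⟩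
  1ℚ * c + fromℕ k * c     ≡⟨ ℚₚ.*-distribʳ-+ c 1ℚ (fromℕ k) ⟨
  (1ℚ + fromℕ k) * c       ≡⟨ cong (_* c) (fromℕ-+ 1 k) ⟨
  fromℕ (suc k) * c        ∎
  where open ≡-Reasoning

recip≡1/ : ∀ {q} (q≢0 : q ≢ 0ℚ) → recip q ≡ (ℚ.1/ q) {{ℚ.≢-nonZero q≢0}}
recip≡1/ {q} q≢0 with q ℚ.≟ 0ℚ
... | yes q≡0 = ⊥-elim (q≢0 q≡0)
... | no  _   = refl

recip-inverseʳ : ∀ {q} → q ≢ 0ℚ → q * recip q ≡ 1ℚ
recip-inverseʳ {q} q≢0 = trans (cong (q *_) (recip≡1/ q≢0)) (ℚₚ.*-inverseʳ q {{ℚ.≢-nonZero q≢0}})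

recip-involutive : ∀ q → recip (recip q) ≡ q
recip-involutive q with q ℚ.≟ 0ℚ
... | yes refl = refl
... | no  q≢0  = trans (recip≡1/ 1/q≢0) (ℚₚ.1/-involutive q)
  where
  instance _ = ℚ.≢-nonZero q≢0
  1/q≢0 : ℚ.1/ q ≢ 0ℚ
  1/q≢0 eq = ℚₚ.1≢0 (trans (sym (ℚₚ.*-inverseʳ q)) (trans (cong (q *_) eq) (ℚₚ.*-zeroʳ q)))

recip-injective : Injective _≡_ _≡_ recip
recip-injective {p} {q} eq = trans (sym (recip-involutive p)) (trans (cong recip eq) (recip-involutive q))

recip-≢0 : ∀ {q} → q ≢ 0ℚ → recip q ≢ 0ℚ
recip-≢0 {q} q≢0 recip-q≡0 = q≢0 (recip-injective (trans recip-q≡0 (sym (recip-involutive 0ℚ))))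

recip-pos : ∀ {q} → 0ℚ < q → 0ℚ < recip q
recip-pos {q} 0<q with q ℚ.≟ 0ℚ
... | yes refl = ⊥-elim (ℚₚ.<-irrefl refl 0<q)
... | no  _    = ℚₚ.positive⁻¹ _ {{ℚₚ.1/pos⇒pos q {{ℚ.positive 0<q}}}}

*-pos : ∀ {p q} → 0ℚ < p → 0ℚ < q → 0ℚ < p * q
*-pos {p} {q} 0<p 0<q = ℚₚ.positive⁻¹ (p * q) {{ℚₚ.pos*pos⇒pos p {{ℚ.positive 0<p}} q {{ℚ.positive 0<q}}}}

*-recip-cancelʳ : ∀ {r} → r ≢ 0ℚ → ∀ p → p * r * recip r ≡ p
*-recip-cancelʳ {r} r≢0 p = begin
  p * r * recip r     ≡⟨ ℚₚ.*-assoc p r (recip r) ⟩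
  p * (r * recip r)   ≡⟨ cong (p *_) (recip-inverseʳ r≢0) ⟩
  p * 1ℚ              ≡⟨ ℚₚ.*-identityʳ p ⟩
  p                   ∎
  where open ≡-Reasoning

*-cancelʳ-≡ : ∀ {p q r} → r ≢ 0ℚ → p * r ≡ q * r → p ≡ q
*-cancelʳ-≡ {p} {q} {r} r≢0 eq =
  trans (sym (*-recip-cancelʳ r≢0 p)) (trans (cong (_* recip r) eq) (*-recip-cancelʳ r≢0 q))

*-cancelˡ-≡ : ∀ {p q r} → r ≢ 0ℚ → r * p ≡ r * q → p ≡ q
*-cancelˡ-≡ {p} {q} {r} r≢0 eq = *-cancelʳ-≡ r≢0 (trans (ℚₚ.*-comm p r) (trans eq (ℚₚ.*-comm r q)))

p*q≡0⇒p≡0 : ∀ {p q} → q ≢ 0ℚ → p * q ≡ 0ℚ → p ≡ 0ℚ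
p*q≡0⇒p≡0 {q = q} q≢0 eq = *-cancelʳ-≡ q≢0 (trans eq (sym (ℚₚ.*-zeroˡ q)))

*-≢0 : ∀ {p q} → p ≢ 0ℚ → q ≢ 0ℚ → p * q ≢ 0ℚ
*-≢0 p≢0 q≢0 pq≡0 = p≢0 (p*q≡0⇒p≡0 q≢0 pq≡0)

p≢q⇒p-q≢0 : ∀ {p q} → p ≢ q → p - q ≢ 0ℚ
p≢q⇒p-q≢0 {p} {q} p≢q p-q≡0 = p≢q (x∙y⁻¹≈ε⇒x≈y p q p-q≡0)

pos⇒≢0 : ∀ {q} → 0ℚ < q → q ≢ 0ℚ
pos⇒≢0 0<q refl = ℚₚ.<-irrefl refl 0<q

-- Cauchy matrices

partial-fractions : ∀ a A b b′ → A + b ≢ 0ℚ → A + b′ ≢ 0ℚ →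
  (a - A) * recip (A + b′) * recip (A + b) * (b′ - b) ≡ (a + b) * recip (A + b) - (a + b′) * recip (A + b′)
partial-fractions a A b b′ A+b≢0 A+b′≢0 = begin
  (a - A) * w * u * (b′ - b)
    ≡⟨ solve 6 (λ a A b b′ u w → (a :- A) :* w :* u :* (b′ :- b)
                  := (a :+ b) :* u :* ((A :+ b′) :* w) :- (a :+ b′) :* w :* ((A :+ b) :* u))
         refl a A b b′ u w ⟩
  (a + b) * u * ((A + b′) * w) - (a + b′) * w * ((A + b) * u)
    ≡⟨ cong₂ (λ s t → (a + b) * u * s - (a + b′) * w * t) (recip-inverseʳ A+b′≢0) (recip-inverseʳ A+b≢0) ⟩
  (a + b) * u * 1ℚ - (a + b′) * w * 1ℚ
    ≡⟨ cong₂ _-_ (ℚₚ.*-identityʳ ((a + b) * u)) (ℚₚ.*-identityʳ ((a + b′) * w)) ⟩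
  (a + b) * u - (a + b′) * w ∎
  where
  open ≡-Reasoning
  u = recip (A + b)
  w = recip (A + b′)

cauchy-rows-independent : ∀ k (a b c : Fin k → ℚ) →
  (∀ i j → a i + b j ≢ 0ℚ) → Injective _≡_ _≡_ a → Injective _≡_ _≡_ b →
  (∀ j → sumℚ k (λ i → c i * recip (a i + b j)) ≡ 0ℚ) →
  ∀ i → c i ≡ 0ℚ
cauchy-rows-independent zero    a b c a+b≢0 a-inj b-inj vanish ()
cauchy-rows-independent (suc k) a b c a+b≢0 a-inj b-inj vanish = λ where
    zero    → c₀≡0
    (suc i) → C≡0 i
  where
  open ≡-Reasoning
  a₀ = a zero
  b₀ = b zero
  c₀ = c zero
  A : Fin k → ℚ
  A i = a (suc i)
  B : Fin k → ℚ
  B j = b (suc j)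
  C : Fin k → ℚ
  C i = c (suc i)

  tail : Fin (suc k) → ℚ
  tail j = sumℚ k (λ i → C i * recip (A i + b j))

  weighted-tail : ∀ j → (a₀ + b j) * tail j ≡ - c₀
  weighted-tail j = inverseʳ-unique c₀ _ (begin
    c₀ + (a₀ + b j) * tail j
      ≡⟨ cong (λ t → t + (a₀ + b j) * tail j) (ℚₚ.*-identityʳ c₀) ⟨
    c₀ * 1ℚ + (a₀ + b j) * tail j
      ≡⟨ cong (λ t → c₀ * t + (a₀ + b j) * tail j) (recip-inverseʳ (a+b≢0 zero j)) ⟨
    c₀ * ((a₀ + b j) * recip (a₀ + b j)) + (a₀ + b j) * tail j
      ≡⟨ solve 4 (λ c s r T → c :* (s :* r) :+ s :* T := s :* (c :* r :+ T)) refl c₀ (a₀ + b j) (recip (a₀ + b j)) (tail j) ⟩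
    (a₀ + b j) * (c₀ * recip (a₀ + b j) + tail j)
      ≡⟨ cong ((a₀ + b j) *_) (vanish j) ⟩
    (a₀ + b j) * 0ℚ
      ≡⟨ ℚₚ.*-zeroʳ (a₀ + b j) ⟩
    0ℚ ∎)

  -- Combining equation j with equation 0, weighted by a₀ + b j and a₀ + b₀, eliminates c₀ and
  -- leaves a Cauchy system of size k in the unknowns D i (up to the factor b₀ - B j).
  D : Fin k → ℚ
  D i = C i * ((a₀ - A i) * recip (A i + b₀))

  eliminated-summand : ∀ i j → D i * recip (A i + B j) * (b₀ - B j)
                               ≡ (a₀ + B j) * (C i * recip (A i + B j)) - (a₀ + b₀) * (C i * recip (A i + b₀))
  eliminated-summand i j = begin
    D i * recip (A i + B j) * (b₀ - B j)
      ≡⟨ solve 5 (λ c x r s y → c :* (x :* r) :* s :* y := c :* (x :* r :* s :* y)) refl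
           (C i) (a₀ - A i) (recip (A i + b₀)) (recip (A i + B j)) (b₀ - B j) ⟩
    C i * ((a₀ - A i) * recip (A i + b₀) * recip (A i + B j) * (b₀ - B j))
      ≡⟨ cong (C i *_) (partial-fractions a₀ (A i) (B j) b₀ (a+b≢0 (suc i) (suc j)) (a+b≢0 (suc i) zero)) ⟩
    C i * ((a₀ + B j) * recip (A i + B j) - (a₀ + b₀) * recip (A i + b₀))
      ≡⟨ solve 5 (λ c s r t q → c :* (s :* r :- t :* q) := s :* (c :* r) :- t :* (c :* q)) refl
           (C i) (a₀ + B j) (recip (A i + B j)) (a₀ + b₀) (recip (A i + b₀)) ⟩
    (a₀ + B j) * (C i * recip (A i + B j)) - (a₀ + b₀) * (C i * recip (A i + b₀)) ∎

  eliminated-vanish : ∀ j → sumℚ k (λ i → D i * recip (A i + B j)) ≡ 0ℚ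
  eliminated-vanish j = p*q≡0⇒p≡0 (p≢q⇒p-q≢0 (Finₚ.0≢1+n ∘ b-inj)) (begin
    sumℚ k (λ i → D i * recip (A i + B j)) * (b₀ - B j)
      ≡⟨ sumℚ-*ʳ k (b₀ - B j) _ ⟨
    sumℚ k (λ i → D i * recip (A i + B j) * (b₀ - B j))
      ≡⟨ sumFin-cong k (λ i → eliminated-summand i j) ⟩
    sumℚ k (λ i → (a₀ + B j) * (C i * recip (A i + B j)) - (a₀ + b₀) * (C i * recip (A i + b₀)))
      ≡⟨ sumℚ-linear k (a₀ + B j) (a₀ + b₀) _ _ ⟩
    (a₀ + B j) * tail (suc j) - (a₀ + b₀) * tail zero
      ≡⟨ cong₂ _-_ (weighted-tail (suc j)) (weighted-tail zero) ⟩
    - c₀ - - c₀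
      ≡⟨ ℚₚ.+-inverseʳ (- c₀) ⟩
    0ℚ ∎)

  D≡0 : ∀ i → D i ≡ 0ℚ
  D≡0 = cauchy-rows-independent k A B D (λ i j → a+b≢0 (suc i) (suc j))
          (λ eq → Finₚ.suc-injective (a-inj eq)) (λ eq → Finₚ.suc-injective (b-inj eq)) eliminated-vanish

  C≡0 : ∀ i → C i ≡ 0ℚ
  C≡0 i = p*q≡0⇒p≡0 (*-≢0 (p≢q⇒p-q≢0 (Finₚ.0≢1+n ∘ a-inj)) (recip-≢0 (a+b≢0 (suc i) zero))) (D≡0 i)

  c₀≡0 : c₀ ≡ 0ℚ
  c₀≡0 = p*q≡0⇒p≡0 (recip-≢0 (a+b≢0 zero zero)) (begin
    c₀ * recip (a₀ + b₀)             ≡⟨ ℚₚ.+-identityʳ _ ⟨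
    c₀ * recip (a₀ + b₀) + 0ℚ        ≡⟨ cong (_+_ (c₀ * recip (a₀ + b₀))) tail₀≡0 ⟨
    c₀ * recip (a₀ + b₀) + tail zero ≡⟨ vanish zero ⟩
    0ℚ                               ∎)
    where
    tail₀≡0 : tail zero ≡ 0ℚ
    tail₀≡0 = sumℚ-zero k (λ i → trans (cong (_* recip (A i + b₀)) (C≡0 i)) (ℚₚ.*-zeroˡ (recip (A i + b₀))))

-- Regular graphs and joins

⋈-adj-↑ˡ-↑ˡ : ∀ G H a b → adj (G ⋈ H) (a ↑ˡ n H) (b ↑ˡ n H) ≡ adj G a b
⋈-adj-↑ˡ-↑ˡ G H a b rewrite Finₚ.splitAt-↑ˡ (n G) a (n H) | Finₚ.splitAt-↑ˡ (n G) b (n H) = refl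

⋈-adj-↑ˡ-↑ʳ : ∀ G H a b → adj (G ⋈ H) (a ↑ˡ n H) (n G ↑ʳ b) ≡ true
⋈-adj-↑ˡ-↑ʳ G H a b rewrite Finₚ.splitAt-↑ˡ (n G) a (n H) | Finₚ.splitAt-↑ʳ (n G) (n H) b = refl

⋈-adj-↑ʳ-↑ˡ : ∀ G H a b → adj (G ⋈ H) (n G ↑ʳ a) (b ↑ˡ n H) ≡ true
⋈-adj-↑ʳ-↑ˡ G H a b rewrite Finₚ.splitAt-↑ʳ (n G) (n H) a | Finₚ.splitAt-↑ˡ (n G) b (n H) = refl

⋈-adj-↑ʳ-↑ʳ : ∀ G H a b → adj (G ⋈ H) (n G ↑ʳ a) (n G ↑ʳ b) ≡ adj H a b
⋈-adj-↑ʳ-↑ʳ G H a b rewrite Finₚ.splitAt-↑ʳ (n G) (n H) a | Finₚ.splitAt-↑ʳ (n G) (n H) b = refl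

sumℕ-ones : ∀ k → sumFin ℕ._+_ 0 k (λ _ → 1) ≡ k
sumℕ-ones k = trans (sumℕ-const k 1) (ℕₚ.*-identityʳ k)

degree-⋈-↑ˡ : ∀ G H a → degree (G ⋈ H) (a ↑ˡ n H) ≡ degree G a ℕ.+ n H
degree-⋈-↑ˡ G H a = trans (sumFin-++ ℕₚ.+-0-isMonoid (n G) (n H) _) (cong₂ ℕ._+_
  (sumFin-cong (n G) (λ b → cong (λ x → if x then 1 else 0) (⋈-adj-↑ˡ-↑ˡ G H a b)))
  (trans (sumFin-cong (n H) (λ b → cong (λ x → if x then 1 else 0) (⋈-adj-↑ˡ-↑ʳ G H a b))) (sumℕ-ones (n H))))

degree-⋈-↑ʳ : ∀ G H b → degree (G ⋈ H) (n G ↑ʳ b) ≡ degree H b ℕ.+ n G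
degree-⋈-↑ʳ G H b = trans (sumFin-++ ℕₚ.+-0-isMonoid (n G) (n H) _) (trans (cong₂ ℕ._+_
  (trans (sumFin-cong (n G) (λ a → cong (λ x → if x then 1 else 0) (⋈-adj-↑ʳ-↑ˡ G H b a))) (sumℕ-ones (n G)))
  (sumFin-cong (n H) (λ a → cong (λ x → if x then 1 else 0) (⋈-adj-↑ʳ-↑ʳ G H b a))))
  (ℕₚ.+-comm (n G) (degree H b)))

Regular : Graph → ℕ → Set
Regular G d = ∀ v → degree G v ≡ d

⋈-regular : ∀ {G H d e} → Regular G d → Regular H e → d ℕ.+ n H ≡ e ℕ.+ n G → Regular (G ⋈ H) (d ℕ.+ n H)
⋈-regular {G} {H} {d} G-reg H-reg balanced v = by-side (splitAt (n G) v) refl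
  where
  by-side : ∀ side → splitAt (n G) v ≡ side → degree (G ⋈ H) v ≡ d ℕ.+ n H
  by-side (inj₁ a) split = subst (λ w → degree (G ⋈ H) w ≡ d ℕ.+ n H) (Finₚ.splitAt⁻¹-↑ˡ split)
    (trans (degree-⋈-↑ˡ G H a) (cong (ℕ._+ n H) (G-reg a)))
  by-side (inj₂ b) split = subst (λ w → degree (G ⋈ H) w ≡ d ℕ.+ n H) (Finₚ.splitAt⁻¹-↑ʳ split)
    (trans (degree-⋈-↑ʳ G H b) (trans (cong (ℕ._+ n G) (H-reg b)) (sym balanced)))

havgval-⋈-regular : ∀ {G H d e} → Regular G d → Regular H e →
  havgval (G ⋈ H) ≡ fromℕ (n G ℕ.+ n H) * recip (fromℕ (n G) * recip (fromℕ (d ℕ.+ n H)) + fromℕ (n H) * recip (fromℕ (e ℕ.+ n G)))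
havgval-⋈-regular {G} {H} {d} {e} G-reg H-reg = cong (λ s → fromℕ (n G ℕ.+ n H) * recip s) (begin
  sumℚ (n G ℕ.+ n H) (λ v → recip (fromℕ (degree (G ⋈ H) v)))
    ≡⟨ sumFin-++ ℚₚ.+-0-isMonoid (n G) (n H) _ ⟩
  sumℚ (n G) (λ a → recip (fromℕ (degree (G ⋈ H) (a ↑ˡ n H)))) + sumℚ (n H) (λ b → recip (fromℕ (degree (G ⋈ H) (n G ↑ʳ b))))
    ≡⟨ cong₂ _+_ (sumFin-cong (n G) (λ a → cong (λ x → recip (fromℕ x)) (trans (degree-⋈-↑ˡ G H a) (cong (ℕ._+ n H) (G-reg a)))))
                 (sumFin-cong (n H) (λ b → cong (λ x → recip (fromℕ x)) (trans (degree-⋈-↑ʳ G H b) (cong (ℕ._+ n G) (H-reg b))))) ⟩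
  sumℚ (n G) (λ _ → recip (fromℕ (d ℕ.+ n H))) + sumℚ (n H) (λ _ → recip (fromℕ (e ℕ.+ n G)))
    ≡⟨ cong₂ _+_ (sumℚ-const (n G) _) (sumℚ-const (n H) _) ⟩
  fromℕ (n G) * recip (fromℕ (d ℕ.+ n H)) + fromℕ (n H) * recip (fromℕ (e ℕ.+ n G)) ∎)
  where open ≡-Reasoning

edgeless : ℕ → Graph
edgeless m = record { n = m ; adj = λ _ _ → false ; sym = λ _ _ → refl ; irrefl = λ _ → refl }

edgeless-regular : ∀ m → Regular (edgeless m) 0
edgeless-regular m v = trans (sumℕ-const m 0) (ℕₚ.*-zeroʳ m)

_⋈^_ : Graph → ℕ → Graph
G ⋈^ zero  = G
G ⋈^ suc j = (G ⋈^ j) ⋈ (G ⋈^ j)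

⋈^-size : ∀ G j → n (G ⋈^ j) ≡ 2 ^ j ℕ.* n G
⋈^-size G zero    = sym (ℕₚ.*-identityˡ (n G))
⋈^-size G (suc j) = begin
  n (G ⋈^ j) ℕ.+ n (G ⋈^ j)   ≡⟨ cong₂ ℕ._+_ (⋈^-size G j) (⋈^-size G j) ⟩
  X ℕ.+ X                     ≡⟨ cong (X ℕ.+_) (ℕₚ.+-identityʳ X) ⟨
  2 ℕ.* X                     ≡⟨ ℕₚ.*-assoc 2 (2 ^ j) (n G) ⟨
  2 ^ suc j ℕ.* n G           ∎
  where
  open ≡-Reasoning
  X = 2 ^ j ℕ.* n G

⋈^-regular : ∀ {G d} j → Regular G d → Regular (G ⋈^ j) (d ℕ.+ n (G ⋈^ j) ∸ n G)
⋈^-regular {G} {d} zero    G-reg = subst (Regular G) (sym (ℕₚ.m+n∸n≡m d (n G))) G-reg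
⋈^-regular {G} {d} (suc j) G-reg =
  subst (Regular (G ⋈^ suc j)) degree-identity (⋈-regular (⋈^-regular j G-reg) (⋈^-regular j G-reg) refl)
  where
  open ≡-Reasoning
  m = n G
  mⱼ = n (G ⋈^ j)
  m≤mⱼ : m ℕ.≤ mⱼ
  m≤mⱼ = subst (m ℕ.≤_) (sym (⋈^-size G j)) (ℕₚ.m≤n*m m (2 ^ j) {{ℕₚ.m^n≢0 2 j}})
  degree-identity : d ℕ.+ mⱼ ∸ m ℕ.+ mⱼ ≡ d ℕ.+ (mⱼ ℕ.+ mⱼ) ∸ m
  degree-identity = begin
    d ℕ.+ mⱼ ∸ m ℕ.+ mⱼ    ≡⟨ ℕₚ.+-∸-comm mⱼ (ℕₚ.≤-trans m≤mⱼ (ℕₚ.m≤n+m mⱼ d)) ⟨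
    d ℕ.+ mⱼ ℕ.+ mⱼ ∸ m    ≡⟨ cong (_∸ m) (ℕₚ.+-assoc d mⱼ mⱼ) ⟩
    d ℕ.+ (mⱼ ℕ.+ mⱼ) ∸ m  ∎

-- The Cauchy rows of M

module CauchyRows (k : ℕ) where

  N : ℕ
  N = 2 ^ k

  N>0 : 0 ℕ.< N
  N>0 = ℕₚ.m^n>0 2 k

  row : Fin k → Graph
  row s = edgeless (2 ^ toℕ s) ⋈^ (k ∸ toℕ s)

  2^s≤N : ∀ (s : Fin k) → 2 ^ toℕ s ℕ.≤ N
  2^s≤N s = ℕₚ.^-monoʳ-≤ 2 (ℕₚ.<⇒≤ (Finₚ.toℕ<n s))

  row-size : ∀ s → n (row s) ≡ N
  row-size s = begin
    n (row s)                        ≡⟨ ⋈^-size (edgeless (2 ^ toℕ s)) (k ∸ toℕ s) ⟩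
    2 ^ (k ∸ toℕ s) ℕ.* 2 ^ toℕ s    ≡⟨ ℕₚ.^-distribˡ-+-* 2 (k ∸ toℕ s) (toℕ s) ⟨
    2 ^ (k ∸ toℕ s ℕ.+ toℕ s)        ≡⟨ cong (2 ^_) (ℕₚ.m∸n+n≡m (ℕₚ.<⇒≤ (Finₚ.toℕ<n s))) ⟩
    N                                ∎
    where open ≡-Reasoning

  row-nonempty : ∀ s → Nonempty (row s)
  row-nonempty s = subst (0 ℕ.<_) (sym (row-size s)) N>0

  rowDegree : Fin k → ℕ
  rowDegree s = N ∸ 2 ^ toℕ s

  row-regular : ∀ s → Regular (row s) (rowDegree s)
  row-regular s = subst (Regular (row s)) (cong (_∸ 2 ^ toℕ s) (row-size s))
                    (⋈^-regular (k ∸ toℕ s) (edgeless-regular (2 ^ toℕ s)))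

  weight : Fin k → ℚ
  weight s = fromℕ N * recip (fromℕ (rowDegree s ℕ.+ N))

  M-row : ∀ s t → M (row s) (row t) ≡ fromℕ (N ℕ.+ N) * recip (weight s + weight t)
  M-row s t = trans (havgval-⋈-regular (row-regular s) (row-regular t))
    (cong₂ (λ m m′ → fromℕ (m ℕ.+ m′) * recip (fromℕ m * recip (fromℕ (rowDegree s ℕ.+ m′)) + fromℕ m′ * recip (fromℕ (rowDegree t ℕ.+ m))))
           (row-size s) (row-size t))

  weight-pos : ∀ s → 0ℚ < weight s
  weight-pos s = *-pos (fromℕ-pos N>0) (recip-pos (fromℕ-pos degree+N>0))
    where
    degree+N>0 : 0 ℕ.< rowDegree s ℕ.+ N
    degree+N>0 = ℕₚ.<-≤-trans N>0 (ℕₚ.m≤n+m N (rowDegree s))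

  weight-sum≢0 : ∀ s t → weight s + weight t ≢ 0ℚ
  weight-sum≢0 s t = pos⇒≢0 (ℚₚ.+-mono-< (weight-pos s) (weight-pos t))

  weight-injective : Injective _≡_ _≡_ weight
  weight-injective {s} {t} eq = Finₚ.toℕ-injective (begin
    toℕ s                  ≡⟨ ⌊log₂[2^n]⌋≡n (toℕ s) ⟨
    ⌊log₂ 2 ^ toℕ s ⌋      ≡⟨ cong ⌊log₂_⌋ (ℕₚ.∸-cancelˡ-≡ (2^s≤N s) (2^s≤N t) rowDegree-eq) ⟩
    ⌊log₂ 2 ^ toℕ t ⌋      ≡⟨ ⌊log₂[2^n]⌋≡n (toℕ t) ⟩
    toℕ t                  ∎)
    where
    open ≡-Reasoning
    N≢0 : fromℕ N ≢ 0ℚ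
    N≢0 = pos⇒≢0 (fromℕ-pos N>0)
    rowDegree-eq : rowDegree s ≡ rowDegree t
    rowDegree-eq = ℕₚ.+-cancelʳ-≡ N _ _ (fromℕ-injective (recip-injective (*-cancelˡ-≡ N≢0 eq)))

  rows-independent : RowsIndependent k row
  rows-independent c vanish s =
    p*q≡0⇒p≡0 K≢0 (cauchy-rows-independent k weight weight (λ s → c s * K) weight-sum≢0
                     weight-injective weight-injective columns s)
    where
    K : ℚ
    K = fromℕ (N ℕ.+ N)
    K≢0 : K ≢ 0ℚ
    K≢0 = pos⇒≢0 (fromℕ-pos (ℕₚ.<-≤-trans N>0 (ℕₚ.m≤m+n N N)))
    columns : ∀ t → sumℚ k (λ s → c s * K * recip (weight s + weight t)) ≡ 0ℚ
    columns t = trans (sumFin-cong k (λ s → trans (ℚₚ.*-assoc (c s) K _) (cong (c s *_) (sym (M-row s t)))))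
                      (vanish (row t) (row-nonempty t))

mainTheorem18 : InfiniteRank
mainTheorem18 k = row , row-nonempty , rows-independent
  where open CauchyRows k
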